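{- If $G$ is a complete multipartite graph that is neither a complete graph nor a tree, then $tpc(G)=3$.
   Context: All graphs are simple, finite and undirected. A graph is total-colored if every vertex and every edge receives a color. A path $v_1v_2\ldots v_s$ in a total-colored graph is a total proper path if (i) any two adjacent edges on the path have different colors, (ii) any two adjacent internal vertices of the path (vertices among $v_2,\ldots,v_{s-1}$) have different colors, and (iii) every internal vertex of the path has a color different from the colors of its two incident edges on the path. A total-colored graph is total proper connected if every two vertices are joined by a total proper path. For a connected graph $G$, the total proper connection number $tpc(G)$ is the smallest number of colors in a total-coloring making $G$ total proper connected. -}

module Defs where

open import Data.Nat using (ℕ; _<_; _≤_)
open import Data.Fin using (Fin)
open import Data.List using (List; []; _∷_; length; head; last)
open import Data.List.Relation.Unary.Linked using (Linked)
open import Data.List.Relation.Unary.Unique.Propositional using (Unique)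
open import Data.Maybe using (just)
open import Data.Product using (Σ; ∃; _×_)
open import Data.Unit using (⊤)
open import Data.Empty using (⊥)
open import Function.Bundles using (_⇔_)
open import Function.Definitions using (Surjective)
open import Relation.Binary.PropositionalEquality using (_≡_; _≢_)
open import Relation.Nullary using (¬_)

record Graph (n : ℕ) : Set₁ where
  field
    Adj   : Fin n → Fin n → Set
    sym   : ∀ {u v} → Adj u v → Adj v u
    irrefl : ∀ {u} → ¬ Adj u u
open Graph public

module _ {n : ℕ} (G : Graph n) where

  IsPath : List (Fin n) → Set
  IsPath xs = Unique xs × Linked (Adj G) xs

  PathFromTo : Fin n → Fin n → List (Fin n) → Set
  PathFromTo u v xs = IsPath xs × head xs ≡ just u × last xs ≡ just v

  Connected : Set
  Connected = ∀ u v → ∃ λ xs → PathFromTo u v xs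

  IsCycle : List (Fin n) → Set
  IsCycle xs = 3 ≤ length xs × IsPath xs ×
    Σ (Fin n) λ a → Σ (Fin n) λ b → head xs ≡ just a × last xs ≡ just b × Adj G b a

  Acyclic : Set
  Acyclic = ∀ xs → ¬ IsCycle xs

  IsTree : Set
  IsTree = Connected × Acyclic

  IsComplete : Set
  IsComplete = ∀ u v → u ≢ v → Adj G u v

  IsCompleteMultipartite : Set
  IsCompleteMultipartite =
    Σ ℕ λ k → 2 ≤ k × Σ (Fin n → Fin k) λ part →
      Surjective _≡_ _≡_ part × (∀ u v → Adj G u v ⇔ (part u ≢ part v))

  record TotalColoring (c : ℕ) : Set where
    field
      vcol : Fin n → Fin c
      ecol : Fin n → Fin n → Fin c
      ecol-sym : ∀ u v → Adj G u v → ecol u v ≡ ecol v u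
  open TotalColoring public

  Triples : (Fin n → Fin n → Fin n → Set) → List (Fin n) → Set
  Triples P (a ∷ b ∷ c ∷ xs) = P a b c × Triples P (b ∷ c ∷ xs)
  Triples P _ = ⊤

  Quads : (Fin n → Fin n → Fin n → Fin n → Set) → List (Fin n) → Set
  Quads P (a ∷ b ∷ c ∷ d ∷ xs) = P a b c d × Quads P (b ∷ c ∷ d ∷ xs)
  Quads P _ = ⊤

  module _ {c : ℕ} (χ : TotalColoring c) where
    TotalProperPath : List (Fin n) → Set
    TotalProperPath xs =
      Triples (λ a b d → ecol χ a b ≢ ecol χ b d
                        × vcol χ b ≢ ecol χ a b
                        × vcol χ b ≢ ecol χ b d) xs
      × Quads (λ a b d e → vcol χ b ≢ vcol χ d) xs

    TotalProperConnected : Set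
    TotalProperConnected =
      ∀ u v → ∃ λ xs → PathFromTo u v xs × TotalProperPath xs

  TPCWith : ℕ → Set
  TPCWith c = Σ (TotalColoring c) TotalProperConnected

  TPCEq : ℕ → Set
  TPCEq k = TPCWith k × (∀ c → c < k → ¬ TPCWith c)

-- Two distinct vertices x₁, x₂ of a common part X are non-adjacent, so a total proper path
-- between them has an internal vertex whose colour and two edge colours are pairwise
-- distinct: fewer than three colours never suffice. Conversely, as G is not a star, there are
-- two vertices y₁ ≠ y₂ outside X. Colour every vertex and edge according to the roles (x₁, x₂,
-- y₁, y₂ or other) of its endpoints. Two non-adjacent vertices are then joined by a path of
-- length 2, 3 or 4 running through x₁ and y₁ (and possibly x₂ or y₂), and whether such a path
-- is total proper depends only on the roles along it, a finite check done by computation.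
module Submission where

open import Defs hiding (sym)
open import Data.Nat using (ℕ; zero; suc; _<_; s≤s; z≤n)
open import Data.Fin using (Fin; zero; suc; _≟_; #_)
open import Data.Fin.Properties using (all?; any?)
open import Data.List using (List; []; _∷_; map; last)
open import Data.List.Relation.Unary.Linked using (Linked; [-]; _∷_)
open import Data.List.Relation.Unary.All using (All; []; _∷_)
open import Data.List.Relation.Unary.AllPairs using ([]; _∷_)
open import Data.Maybe using (just)
open import Data.Product using (∃; _×_; _,_)
open import Data.Sum using (_⊎_; inj₁; inj₂)
open import Data.Unit using (tt)
open import Data.Empty using (⊥; ⊥-elim)
open import Function using (_∘_)
open import Function.Bundles using (_⇔_; Equivalence)
open import Function.Definitions using (Surjective)
open import Relation.Binary.PropositionalEquality using (_≡_; _≢_; refl; sym; trans; ≢-sym)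
open import Relation.Nullary using (¬_; Dec; yes; no; ¬?)
open import Relation.Nullary.Decidable using (_×-dec_; _→-dec_; from-yes; decidable-stable)

¬three-distinct : ∀ {c} → c < 3 → (p q r : Fin c) → p ≢ q → r ≢ p → r ≢ q → ⊥
¬three-distinct {suc zero}       _ zero       zero       _          p≢q _   _   = p≢q refl
¬three-distinct {suc (suc zero)} _ zero       zero       _          p≢q _   _   = p≢q refl
¬three-distinct {suc (suc zero)} _ (suc zero) (suc zero) _          p≢q _   _   = p≢q refl
¬three-distinct {suc (suc zero)} _ zero       (suc zero) zero       _   r≢p _   = r≢p refl
¬three-distinct {suc (suc zero)} _ zero       (suc zero) (suc zero) _   _   r≢q = r≢q refl
¬three-distinct {suc (suc zero)} _ (suc zero) zero       zero       _   _   r≢q = r≢q refl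
¬three-distinct {suc (suc zero)} _ (suc zero) zero       (suc zero) _   r≢p _   = r≢p refl
¬three-distinct {suc (suc (suc _))} (s≤s (s≤s (s≤s ()))) _ _ _ _ _ _

complete : (m : ℕ) → Graph m
complete m = record { Adj = _≢_ ; sym = ≢-sym ; irrefl = λ u≢u → u≢u refl }

module _ {n : ℕ} (G : Graph n) where

  Adj⇒≢ : ∀ {u v} → Adj G u v → u ≢ v
  Adj⇒≢ uv refl = irrefl G uv

  path₁ : ∀ u → PathFromTo G u u (u ∷ [])
  path₁ u = ([] ∷ [] , [-]) , refl , refl

  path₂ : ∀ {a b} → Adj G a b → PathFromTo G a b (a ∷ b ∷ [])
  path₂ ab = ((Adj⇒≢ ab ∷ []) ∷ [] ∷ [] , ab ∷ [-]) , refl , refl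

  path₃ : ∀ {a b c} → Adj G a b → Adj G b c → a ≢ c → PathFromTo G a c (a ∷ b ∷ c ∷ [])
  path₃ ab bc a≢c =
    ((Adj⇒≢ ab ∷ a≢c ∷ []) ∷ (Adj⇒≢ bc ∷ []) ∷ [] ∷ [] , ab ∷ bc ∷ [-]) , refl , refl

  path₄ : ∀ {a b c d} → Adj G a b → Adj G b c → Adj G c d →
          a ≢ c → a ≢ d → b ≢ d → PathFromTo G a d (a ∷ b ∷ c ∷ d ∷ [])
  path₄ ab bc cd a≢c a≢d b≢d =
    ((Adj⇒≢ ab ∷ a≢c ∷ a≢d ∷ []) ∷ (Adj⇒≢ bc ∷ b≢d ∷ []) ∷ (Adj⇒≢ cd ∷ []) ∷ [] ∷ [] ,
     ab ∷ bc ∷ cd ∷ [-]) , refl , refl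

  path₅ : ∀ {a b c d e} → Adj G a b → Adj G b c → Adj G c d → Adj G d e →
          a ≢ c → a ≢ d → a ≢ e → b ≢ d → b ≢ e → c ≢ e →
          PathFromTo G a e (a ∷ b ∷ c ∷ d ∷ e ∷ [])
  path₅ ab bc cd de a≢c a≢d a≢e b≢d b≢e c≢e =
    ((Adj⇒≢ ab ∷ a≢c ∷ a≢d ∷ a≢e ∷ []) ∷ (Adj⇒≢ bc ∷ b≢d ∷ b≢e ∷ []) ∷
     (Adj⇒≢ cd ∷ c≢e ∷ []) ∷ (Adj⇒≢ de ∷ []) ∷ [] ∷ [] ,
     ab ∷ bc ∷ cd ∷ de ∷ [-]) , refl , refl

  nonadjacent⇒tpc≥3 : ∀ {u v c} → u ≢ v → ¬ Adj G u v → c < 3 → ¬ TPCWith G c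
  nonadjacent⇒tpc≥3 {u} {v} u≢v ¬uv c<3 (χ , tpc) with tpc u v
  ... | a ∷ [] , (_ , refl , refl) , _ = u≢v refl
  ... | a ∷ b ∷ [] , ((_ , ab ∷ _) , refl , refl) , _ = ¬uv ab
  ... | a ∷ b ∷ d ∷ _ , _ , ((ab≢bd , b≢ab , b≢bd) , _) , _ =
    ¬three-distinct c<3 (ecol χ a b) (ecol χ b d) (vcol χ b) ab≢bd b≢ab b≢bd

  star-acyclic : (h : Fin n) → (∀ {p q} → Adj G p q → p ≡ h ⊎ q ≡ h) → Acyclic G
  star-acyclic h centre [] (() , _)
  star-acyclic h centre (_ ∷ []) (s≤s () , _)
  star-acyclic h centre (_ ∷ _ ∷ []) (s≤s (s≤s ()) , _)
  star-acyclic h centre (p ∷ q ∷ r ∷ rest)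
    (_ , ((p≢q ∷ p≢r ∷ _) ∷ (q≢r ∷ q≢rest) ∷ _ , pq ∷ qr ∷ rest-linked) , _ , b , refl , ends , bp)
    with centre pq
  ... | inj₁ refl with centre qr
  ...   | inj₁ refl = p≢q refl
  ...   | inj₂ refl = p≢r refl
  star-acyclic h centre (p ∷ q ∷ r ∷ rest)
    (_ , ((p≢q ∷ _) ∷ (q≢r ∷ q≢rest) ∷ _ , _ ∷ _ ∷ rest-linked) , _ , b , refl , ends , bp)
    | inj₂ refl = after-r rest rest-linked q≢rest ends
    where
    after-r : ∀ rest → Linked (Adj G) (r ∷ rest) → All (q ≢_) rest →
              last (p ∷ q ∷ r ∷ rest) ≡ just b → ⊥
    after-r [] _ _ refl with centre bp
    ... | inj₁ refl = q≢r refl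
    ... | inj₂ refl = p≢q refl
    after-r (s ∷ _) (rs ∷ _) (q≢s ∷ _) _ with centre rs
    ... | inj₁ refl = q≢r refl
    ... | inj₂ refl = q≢s refl

  triples? : ∀ {P} → (∀ a b d → Dec (P a b d)) → ∀ xs → Dec (Triples G P xs)
  triples? P? (a ∷ b ∷ d ∷ xs) = P? a b d ×-dec triples? P? (b ∷ d ∷ xs)
  triples? P? []               = yes tt
  triples? P? (_ ∷ [])         = yes tt
  triples? P? (_ ∷ _ ∷ [])     = yes tt

  quads? : ∀ {P} → (∀ a b d e → Dec (P a b d e)) → ∀ xs → Dec (Quads G P xs)
  quads? P? (a ∷ b ∷ d ∷ e ∷ xs) = P? a b d e ×-dec quads? P? (b ∷ d ∷ e ∷ xs)
  quads? P? []                   = yes tt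
  quads? P? (_ ∷ [])             = yes tt
  quads? P? (_ ∷ _ ∷ [])         = yes tt
  quads? P? (_ ∷ _ ∷ _ ∷ [])     = yes tt

  totalProperPath? : ∀ {c} (χ : TotalColoring G c) xs → Dec (TotalProperPath G χ xs)
  totalProperPath? χ xs =
    triples? (λ a b d → ¬? (ecol χ a b ≟ ecol χ b d) ×-dec ¬? (vcol χ b ≟ ecol χ a b)
                        ×-dec ¬? (vcol χ b ≟ ecol χ b d)) xs
    ×-dec quads? (λ a b d e → ¬? (vcol χ b ≟ vcol χ d)) xs

module _ {n m c : ℕ} (G : Graph n) (H : Graph m) (f : Fin n → Fin m) (χ : TotalColoring H c)
         (ecol-symmetric : ∀ a b → ecol χ a b ≡ ecol χ b a) where

  pullback : TotalColoring G c
  pullback = record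
    { vcol = vcol χ ∘ f
    ; ecol = λ u v → ecol χ (f u) (f v)
    ; ecol-sym = λ u v _ → ecol-symmetric (f u) (f v)
    }

  pullback-properPath : ∀ xs → TotalProperPath H χ (map f xs) → TotalProperPath G pullback xs
  pullback-properPath xs (ts , qs) = triples xs ts , quads xs qs
    where
    triples : ∀ xs → Triples H _ (map f xs) → Triples G _ xs
    triples (a ∷ b ∷ d ∷ xs) (t , ts) = t , triples (b ∷ d ∷ xs) ts
    triples []               _        = tt
    triples (_ ∷ [])         _        = tt
    triples (_ ∷ _ ∷ [])     _        = tt

    quads : ∀ xs → Quads H _ (map f xs) → Quads G _ xs
    quads (a ∷ b ∷ d ∷ e ∷ xs) (q , qs) = q , quads (b ∷ d ∷ e ∷ xs) qs
    quads []                   _        = tt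
    quads (_ ∷ [])             _        = tt
    quads (_ ∷ _ ∷ [])         _        = tt
    quads (_ ∷ _ ∷ _ ∷ [])     _        = tt

-- Roles are elements of Fin 5 so that statements about finitely many roles are decided by all?.
Role : Set
Role = Fin 5

pattern Y₁    = zero
pattern X₁    = suc zero
pattern Y₂    = suc (suc zero)
pattern X₂    = suc (suc (suc zero))
pattern Other = suc (suc (suc (suc zero)))

roleVertexColour : Role → Fin 3
roleVertexColour X₁ = # 1
roleVertexColour Y₂ = # 2
roleVertexColour X₂ = # 2
roleVertexColour _  = # 0

roleEdgeColour : Role → Role → Fin 3
roleEdgeColour X₁ Y₁ = # 2
roleEdgeColour Y₁ X₁ = # 2
roleEdgeColour Y₁ _  = # 1
roleEdgeColour _  Y₁ = # 1
roleEdgeColour X₁ _  = # 0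
roleEdgeColour _  X₁ = # 0
roleEdgeColour Y₂ _  = # 1
roleEdgeColour _  Y₂ = # 1
roleEdgeColour _  _  = # 0

roleEdgeColour-sym : ∀ a b → roleEdgeColour a b ≡ roleEdgeColour b a
roleEdgeColour-sym = from-yes (all? λ a → all? λ b → roleEdgeColour a b ≟ roleEdgeColour b a)

roleColouring : TotalColoring (complete 5) 3
roleColouring = record
  { vcol = roleVertexColour
  ; ecol = roleEdgeColour
  ; ecol-sym = λ a b _ → roleEdgeColour-sym a b
  }

RolePath : List Role → Set
RolePath = TotalProperPath (complete 5) roleColouring

rolePath? : ∀ ws → Dec (RolePath ws)
rolePath? = totalProperPath? (complete 5) roleColouring

-- proper-w says that the role word w is a total proper path, ∗ standing for any role allowed
-- by the hypotheses.
proper-X₁Y₁∗ : ∀ {a b r} → a ≡ X₁ → b ≡ Y₁ → r ≢ X₁ → RolePath (a ∷ b ∷ r ∷ [])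
proper-X₁Y₁∗ {r = r} refl refl =
  from-yes (all? λ r → ¬? (r ≟ X₁) →-dec rolePath? (X₁ ∷ Y₁ ∷ r ∷ [])) r

proper-∗Y₁X₁ : ∀ {r b a} → b ≡ Y₁ → a ≡ X₁ → r ≢ X₁ → RolePath (r ∷ b ∷ a ∷ [])
proper-∗Y₁X₁ {r} refl refl =
  from-yes (all? λ r → ¬? (r ≟ X₁) →-dec rolePath? (r ∷ Y₁ ∷ X₁ ∷ [])) r

proper-Y₁X₁∗ : ∀ {b a r} → b ≡ Y₁ → a ≡ X₁ → r ≢ Y₁ → RolePath (b ∷ a ∷ r ∷ [])
proper-Y₁X₁∗ {r = r} refl refl =
  from-yes (all? λ r → ¬? (r ≟ Y₁) →-dec rolePath? (Y₁ ∷ X₁ ∷ r ∷ [])) r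

proper-∗X₁Y₁ : ∀ {r a b} → a ≡ X₁ → b ≡ Y₁ → r ≢ Y₁ → RolePath (r ∷ a ∷ b ∷ [])
proper-∗X₁Y₁ {r} refl refl =
  from-yes (all? λ r → ¬? (r ≟ Y₁) →-dec rolePath? (r ∷ X₁ ∷ Y₁ ∷ [])) r

proper-∗Y₁X₁∗ : ∀ {r b a s} → b ≡ Y₁ → a ≡ X₁ → r ≢ X₁ → s ≢ Y₁ →
                RolePath (r ∷ b ∷ a ∷ s ∷ [])
proper-∗Y₁X₁∗ {r} {s = s} refl refl = from-yes (all? λ r → all? λ s →
  ¬? (r ≟ X₁) →-dec ¬? (s ≟ Y₁) →-dec rolePath? (r ∷ Y₁ ∷ X₁ ∷ s ∷ [])) r s

proper-∗Y₁X₁Y₂∗ : ∀ {r b a b′ s} → b ≡ Y₁ → a ≡ X₁ → b′ ≡ Y₂ → r ≢ X₁ → s ≢ X₁ → s ≢ Y₁ →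
                  RolePath (r ∷ b ∷ a ∷ b′ ∷ s ∷ [])
proper-∗Y₁X₁Y₂∗ {r} {s = s} refl refl refl = from-yes (all? λ r → all? λ s →
  ¬? (r ≟ X₁) →-dec ¬? (s ≟ X₁) →-dec ¬? (s ≟ Y₁) →-dec
  rolePath? (r ∷ Y₁ ∷ X₁ ∷ Y₂ ∷ s ∷ [])) r s

proper-∗X₁Y₁X₂∗ : ∀ {r a b a′ s} → a ≡ X₁ → b ≡ Y₁ → a′ ≡ X₂ → r ≢ Y₁ →
                  s ≢ Y₁ → s ≢ X₁ → s ≢ Y₂ → RolePath (r ∷ a ∷ b ∷ a′ ∷ s ∷ [])
proper-∗X₁Y₁X₂∗ {r} {s = s} refl refl refl = from-yes (all? λ r → all? λ s →
  ¬? (r ≟ Y₁) →-dec ¬? (s ≟ Y₁) →-dec ¬? (s ≟ X₁) →-dec ¬? (s ≟ Y₂) →-dec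
  rolePath? (r ∷ X₁ ∷ Y₁ ∷ X₂ ∷ s ∷ [])) r s

proper-∗X₂Y₁X₁Y₂ : ∀ {r a′ b a b′} → a′ ≡ X₂ → b ≡ Y₁ → a ≡ X₁ → b′ ≡ Y₂ →
                   r ≢ Y₁ → r ≢ X₁ → r ≢ Y₂ → RolePath (r ∷ a′ ∷ b ∷ a ∷ b′ ∷ [])
proper-∗X₂Y₁X₁Y₂ {r} refl refl refl refl = from-yes (all? λ r →
  ¬? (r ≟ Y₁) →-dec ¬? (r ≟ X₁) →-dec ¬? (r ≟ Y₂) →-dec
  rolePath? (r ∷ X₂ ∷ Y₁ ∷ X₁ ∷ Y₂ ∷ [])) r

other-than : ∀ {k} (i : Fin (suc (suc k))) → ∃ λ j → j ≢ i
other-than zero    = suc zero , λ ()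
other-than (suc _) = zero , λ ()

module CompleteMultipartite {n k : ℕ} (G : Graph n) (part : Fin n → Fin (suc (suc k)))
  (part-surjective : Surjective _≡_ _≡_ part) (adj⇔ : ∀ u v → Adj G u v ⇔ (part u ≢ part v)) where

  adjacent : ∀ {u v} → part u ≢ part v → Adj G u v
  adjacent {u} {v} = Equivalence.from (adj⇔ u v)

  nonadjacent : ∀ {u v} → part u ≡ part v → ¬ Adj G u v
  nonadjacent {u} {v} same uv = Equivalence.to (adj⇔ u v) uv same

  adjacent-∈∉ : ∀ {u v i} → part u ≡ i → part v ≢ i → Adj G u v
  adjacent-∈∉ u∈i v∉i = adjacent (λ same → v∉i (trans (sym same) u∈i))

  adjacent-∉∈ : ∀ {u v i} → part u ≢ i → part v ≡ i → Adj G u v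
  adjacent-∉∈ u∉i v∈i = Graph.sym G (adjacent-∈∉ v∈i u∉i)

  vertex-outside : ∀ i → ∃ λ w → part w ≢ i
  vertex-outside i with other-than i
  ... | j , j≢i with part-surjective j
  ...   | w , part⁻¹ = w , λ w∈i → j≢i (trans (sym (part⁻¹ refl)) w∈i)

  distinct-∈∉ : ∀ {u v i} → part u ≡ i → part v ≢ i → u ≢ v
  distinct-∈∉ u∈i v∉i = Adj⇒≢ G (adjacent-∈∉ u∈i v∉i)

  distinct-∉∈ : ∀ {u v i} → part u ≢ i → part v ≡ i → u ≢ v
  distinct-∉∈ u∉i v∈i = Adj⇒≢ G (adjacent-∉∈ u∉i v∈i)

  connected : Connected G
  connected u v with u ≟ v
  ... | yes refl = u ∷ [] , path₁ G u
  ... | no u≢v with part u ≟ part v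
  ... | no parts≢ = u ∷ v ∷ [] , path₂ G (adjacent parts≢)
  ... | yes parts≡ with vertex-outside (part u)
  ...   | w , w∉ = u ∷ w ∷ v ∷ [] , path₃ G (adjacent-∈∉ refl w∉) (adjacent-∉∈ w∉ (sym parts≡)) u≢v

  same-part-pair : ¬ IsComplete G → ∃ λ u → ∃ λ v → u ≢ v × part u ≡ part v
  same-part-pair ¬complete with any? (λ u → any? λ v → ¬? (u ≟ v) ×-dec part u ≟ part v)
  ... | yes pair = pair
  ... | no none = ⊥-elim (¬complete λ u v u≢v → adjacent λ same → none (u , v , u≢v , same))

  star⇒tree : ∀ {x y} → (∀ w → part w ≢ part x → w ≡ y) → IsTree G
  star⇒tree {x} {y} only-y = connected , star-acyclic G y centre
    where
    centre : ∀ {p q} → Adj G p q → p ≡ y ⊎ q ≡ y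
    centre {p} {q} pq with part p ≟ part x
    ... | yes p∈x = inj₂ (only-y q λ q∈x → nonadjacent (trans p∈x (sym q∈x)) pq)
    ... | no p∉x  = inj₁ (only-y p p∉x)

  module RoleColouring {x₁ x₂ y₁ y₂ : Fin n} (x₁≢x₂ : x₁ ≢ x₂) (x₂∈X : part x₂ ≡ part x₁)
    (y₁∉X : part y₁ ≢ part x₁) (y₂∉X : part y₂ ≢ part x₁) (y₁≢y₂ : y₁ ≢ y₂) where

    role : Fin n → Role
    role u with u ≟ y₁
    ... | yes _ = Y₁
    ... | no _ with u ≟ x₁
    ... | yes _ = X₁
    ... | no _ with u ≟ y₂
    ... | yes _ = Y₂
    ... | no _ with u ≟ x₂
    ... | yes _ = X₂
    ... | no _ = Other

    -- The value at Other is junk.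
    vertexOf : Role → Fin n
    vertexOf X₁ = x₁
    vertexOf Y₂ = y₂
    vertexOf X₂ = x₂
    vertexOf _  = y₁

    vertexOf-role : ∀ u → role u ≢ Other → u ≡ vertexOf (role u)
    vertexOf-role u ¬other with u ≟ y₁
    ... | yes u≡y₁ = u≡y₁
    ... | no _ with u ≟ x₁
    ... | yes u≡x₁ = u≡x₁
    ... | no _ with u ≟ y₂
    ... | yes u≡y₂ = u≡y₂
    ... | no _ with u ≟ x₂
    ... | yes u≡x₂ = u≡x₂
    ... | no _ = ⊥-elim (¬other refl)

    role≢ : ∀ {u} r → r ≢ Other → u ≢ vertexOf r → role u ≢ r
    role≢ {u} _ r≢other u≢r refl = u≢r (vertexOf-role u r≢other)

    role≢Y₁ : ∀ {u} → u ≢ y₁ → role u ≢ Y₁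
    role≢Y₁ = role≢ Y₁ λ ()

    role≢X₁ : ∀ {u} → u ≢ x₁ → role u ≢ X₁
    role≢X₁ = role≢ X₁ λ ()

    role≢Y₂ : ∀ {u} → u ≢ y₂ → role u ≢ Y₂
    role≢Y₂ = role≢ Y₂ λ ()

    x₁≢y₁ : x₁ ≢ y₁
    x₁≢y₁ = distinct-∈∉ refl y₁∉X

    x₁≢y₂ : x₁ ≢ y₂
    x₁≢y₂ = distinct-∈∉ refl y₂∉X

    x₂≢y₁ : x₂ ≢ y₁
    x₂≢y₁ = distinct-∈∉ x₂∈X y₁∉X

    x₂≢y₂ : x₂ ≢ y₂
    x₂≢y₂ = distinct-∈∉ x₂∈X y₂∉X

    role-y₁ : role y₁ ≡ Y₁
    role-y₁ with y₁ ≟ y₁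
    ... | yes _ = refl
    ... | no y₁≢y₁ = ⊥-elim (y₁≢y₁ refl)

    role-x₁ : role x₁ ≡ X₁
    role-x₁ with x₁ ≟ y₁
    ... | yes x₁≡y₁ = ⊥-elim (x₁≢y₁ x₁≡y₁)
    ... | no _ with x₁ ≟ x₁
    ... | yes _ = refl
    ... | no x₁≢x₁ = ⊥-elim (x₁≢x₁ refl)

    role-y₂ : role y₂ ≡ Y₂
    role-y₂ with y₂ ≟ y₁
    ... | yes y₂≡y₁ = ⊥-elim (y₁≢y₂ (sym y₂≡y₁))
    ... | no _ with y₂ ≟ x₁
    ... | yes y₂≡x₁ = ⊥-elim (x₁≢y₂ (sym y₂≡x₁))
    ... | no _ with y₂ ≟ y₂
    ... | yes _ = refl
    ... | no y₂≢y₂ = ⊥-elim (y₂≢y₂ refl)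

    role-x₂ : role x₂ ≡ X₂
    role-x₂ with x₂ ≟ y₁
    ... | yes x₂≡y₁ = ⊥-elim (x₂≢y₁ x₂≡y₁)
    ... | no _ with x₂ ≟ x₁
    ... | yes x₂≡x₁ = ⊥-elim (x₁≢x₂ (sym x₂≡x₁))
    ... | no _ with x₂ ≟ y₂
    ... | yes x₂≡y₂ = ⊥-elim (x₂≢y₂ x₂≡y₂)
    ... | no _ with x₂ ≟ x₂
    ... | yes _ = refl
    ... | no x₂≢x₂ = ⊥-elim (x₂≢x₂ refl)

    χ : TotalColoring G 3
    χ = pullback G (complete 5) role roleColouring roleEdgeColour-sym

    via-roles : ∀ xs → RolePath (map role xs) → TotalProperPath G χ xs
    via-roles = pullback-properPath G (complete 5) role roleColouring roleEdgeColour-sym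

    ProperlyJoined : Fin n → Fin n → Set
    ProperlyJoined u v = ∃ λ xs → PathFromTo G u v xs × TotalProperPath G χ xs

    joined-in-X : ∀ {u v} → u ≢ v → part u ≡ part x₁ → part v ≡ part x₁ → ProperlyJoined u v
    joined-in-X {u} {v} u≢v u∈X v∈X with u ≟ x₁ | v ≟ x₁
    ... | yes refl | _ = x₁ ∷ y₁ ∷ v ∷ [] ,
      path₃ G (adjacent-∈∉ refl y₁∉X) (adjacent-∉∈ y₁∉X v∈X) u≢v ,
      via-roles (x₁ ∷ y₁ ∷ v ∷ []) (proper-X₁Y₁∗ role-x₁ role-y₁ (role≢X₁ (≢-sym u≢v)))
    ... | no u≢x₁ | yes refl = u ∷ y₁ ∷ x₁ ∷ [] ,
      path₃ G (adjacent-∈∉ u∈X y₁∉X) (adjacent-∉∈ y₁∉X refl) u≢v ,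
      via-roles (u ∷ y₁ ∷ x₁ ∷ []) (proper-∗Y₁X₁ role-y₁ role-x₁ (role≢X₁ u≢x₁))
    ... | no u≢x₁ | no v≢x₁ = u ∷ y₁ ∷ x₁ ∷ y₂ ∷ v ∷ [] ,
      path₅ G (adjacent-∈∉ u∈X y₁∉X) (adjacent-∉∈ y₁∉X refl) (adjacent-∈∉ refl y₂∉X)
        (adjacent-∉∈ y₂∉X v∈X) u≢x₁ (distinct-∈∉ u∈X y₂∉X) u≢v y₁≢y₂ (≢-sym v≢y₁) (≢-sym v≢x₁) ,
      via-roles (u ∷ y₁ ∷ x₁ ∷ y₂ ∷ v ∷ [])
        (proper-∗Y₁X₁Y₂∗ role-y₁ role-x₁ role-y₂ (role≢X₁ u≢x₁) (role≢X₁ v≢x₁) (role≢Y₁ v≢y₁))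
      where
      v≢y₁ : v ≢ y₁
      v≢y₁ = distinct-∈∉ v∈X y₁∉X

    ∈Y₁⇒∉X : ∀ {w} → part w ≡ part y₁ → part w ≢ part x₁
    ∈Y₁⇒∉X w∈Y w∈X = y₁∉X (trans (sym w∈Y) w∈X)

    joined-in-Y₁ : ∀ {u v} → u ≢ v → part u ≡ part y₁ → part v ≡ part y₁ → ProperlyJoined u v
    joined-in-Y₁ {u} {v} u≢v u∈Y v∈Y with ∈Y₁⇒∉X u∈Y | ∈Y₁⇒∉X v∈Y | u ≟ y₁ | v ≟ y₁ | v ≟ y₂
    ... | _ | v∉X | yes refl | _ | _ = y₁ ∷ x₁ ∷ v ∷ [] ,
      path₃ G (adjacent-∉∈ y₁∉X refl) (adjacent-∈∉ refl v∉X) u≢v ,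
      via-roles (y₁ ∷ x₁ ∷ v ∷ []) (proper-Y₁X₁∗ role-y₁ role-x₁ (role≢Y₁ (≢-sym u≢v)))
    ... | u∉X | _ | no u≢y₁ | yes refl | _ = u ∷ x₁ ∷ y₁ ∷ [] ,
      path₃ G (adjacent-∉∈ u∉X refl) (adjacent-∈∉ refl y₁∉X) u≢v ,
      via-roles (u ∷ x₁ ∷ y₁ ∷ []) (proper-∗X₁Y₁ role-x₁ role-y₁ (role≢Y₁ u≢y₁))
    ... | u∉X | _ | no u≢y₁ | no _ | yes refl = u ∷ x₂ ∷ y₁ ∷ x₁ ∷ y₂ ∷ [] ,
      path₅ G (adjacent-∉∈ u∉X x₂∈X) (adjacent-∈∉ x₂∈X y₁∉X) (adjacent-∉∈ y₁∉X refl)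
        (adjacent-∈∉ refl y₂∉X) u≢y₁ u≢x₁ u≢v (≢-sym x₁≢x₂) x₂≢y₂ y₁≢y₂ ,
      via-roles (u ∷ x₂ ∷ y₁ ∷ x₁ ∷ y₂ ∷ [])
        (proper-∗X₂Y₁X₁Y₂ role-x₂ role-y₁ role-x₁ role-y₂ (role≢Y₁ u≢y₁) (role≢X₁ u≢x₁) (role≢Y₂ u≢v))
      where
      u≢x₁ : u ≢ x₁
      u≢x₁ = distinct-∉∈ u∉X refl
    ... | u∉X | v∉X | no u≢y₁ | no v≢y₁ | no v≢y₂ = u ∷ x₁ ∷ y₁ ∷ x₂ ∷ v ∷ [] ,
      path₅ G (adjacent-∉∈ u∉X refl) (adjacent-∈∉ refl y₁∉X) (adjacent-∉∈ y₁∉X x₂∈X)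
        (adjacent-∈∉ x₂∈X v∉X) u≢y₁ (distinct-∉∈ u∉X x₂∈X) u≢v x₁≢x₂ x₁≢v (≢-sym v≢y₁) ,
      via-roles (u ∷ x₁ ∷ y₁ ∷ x₂ ∷ v ∷ [])
        (proper-∗X₁Y₁X₂∗ role-x₁ role-y₁ role-x₂ (role≢Y₁ u≢y₁) (role≢Y₁ v≢y₁)
          (role≢X₁ (≢-sym x₁≢v)) (role≢Y₂ v≢y₂))
      where
      x₁≢v : x₁ ≢ v
      x₁≢v = distinct-∈∉ refl v∉X

    joined-elsewhere : ∀ {u v} → u ≢ v → part u ≢ part x₁ → part u ≢ part y₁ →
                       part v ≢ part x₁ → part v ≢ part y₁ → ProperlyJoined u v
    joined-elsewhere {u} {v} u≢v u∉X u∉Y v∉X v∉Y = u ∷ y₁ ∷ x₁ ∷ v ∷ [] ,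
      path₄ G (adjacent u∉Y) (adjacent-∉∈ y₁∉X refl) (adjacent-∈∉ refl v∉X)
        u≢x₁ u≢v (distinct-∉∈ (≢-sym v∉Y) refl) ,
      via-roles (u ∷ y₁ ∷ x₁ ∷ v ∷ [])
        (proper-∗Y₁X₁∗ role-y₁ role-x₁ (role≢X₁ u≢x₁) (role≢Y₁ (distinct-∉∈ v∉Y refl)))
      where
      u≢x₁ : u ≢ x₁
      u≢x₁ = distinct-∉∈ u∉X refl

    total-proper-connected : TotalProperConnected G χ
    total-proper-connected u v with u ≟ v
    ... | yes refl = u ∷ [] , path₁ G u , tt , tt
    ... | no u≢v with part u ≟ part v
    ... | no parts≢ = u ∷ v ∷ [] , path₂ G (adjacent parts≢) , tt , tt
    ... | yes parts≡ with part u ≟ part x₁ | part u ≟ part y₁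
    ... | yes u∈X | _ = joined-in-X u≢v u∈X (trans (sym parts≡) u∈X)
    ... | no _ | yes u∈Y = joined-in-Y₁ u≢v u∈Y (trans (sym parts≡) u∈Y)
    ... | no u∉X | no u∉Y =
      joined-elsewhere u≢v u∉X u∉Y (u∉X ∘ trans parts≡) (u∉Y ∘ trans parts≡)

  tpc≤3 : ∀ {x₁ x₂} → x₁ ≢ x₂ → part x₁ ≡ part x₂ → ¬ IsTree G → TPCWith G 3
  tpc≤3 {x₁} x₁≢x₂ same ¬tree with vertex-outside (part x₁)
  ... | y₁ , y₁∉X with any? (λ w → ¬? (part w ≟ part x₁) ×-dec ¬? (w ≟ y₁))
  ...   | yes (y₂ , y₂∉X , y₂≢y₁) = χ , total-proper-connected
    where open RoleColouring x₁≢x₂ (sym same) y₁∉X y₂∉X (≢-sym y₂≢y₁)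
  ...   | no no-y₂ = ⊥-elim (¬tree (star⇒tree only-y₁))
    where
    only-y₁ : ∀ w → part w ≢ part x₁ → w ≡ y₁
    only-y₁ w w∉X = decidable-stable (w ≟ y₁) λ w≢y₁ → no-y₂ (w , w∉X , w≢y₁)

corollary3 : ∀ (n : ℕ) (G : Graph n) → IsCompleteMultipartite G →
    ¬ IsComplete G → ¬ IsTree G → TPCEq G 3
corollary3 n G (suc (suc k) , s≤s (s≤s z≤n) , part , part-surjective , adj⇔) ¬complete ¬tree =
  let x₁ , x₂ , x₁≢x₂ , same = same-part-pair ¬complete
  in tpc≤3 x₁≢x₂ same ¬tree , λ c c<3 → nonadjacent⇒tpc≥3 G x₁≢x₂ (nonadjacent same) c<3
  where open CompleteMultipartite G part part-surjective adj⇔
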